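{- Let $M$ be a maximum induced matching of the grid $G_{5,9}$ and suppose the edge joining $u_1v_1$ and $u_2v_1$ belongs to $M$. If at most one vertex of the column $V_1=\{u_1v_1,\dots,u_5v_1\}$ other than $u_1v_1,u_2v_1$ is saturated by $M$, and $w$ is such a saturated vertex, then $w=u_5v_1$.
   Context: For integers $n,m\geq 2$, the grid $G_{n,m}$ is the Cartesian product of the path $P_n=u_1u_2\cdots u_n$ and the path $P_m=v_1v_2\cdots v_m$; its vertices are written $u_iv_j$ ($1\le i\le n$, $1\le j\le m$), and $u_iv_j$, $u_kv_l$ are adjacent iff either $i=k$ and $|j-l|=1$, or $j=l$ and $|i-k|=1$. An induced matching of a graph $G$ is a set $M$ of pairwise vertex-disjoint edges such that no edge of $G$ joins endpoints of two distinct edges of $M$; a maximum induced matching is one of largest possible size. A vertex is saturated by $M$ if it is an endpoint of an edge of $M$. -}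

module Defs where

open import Data.Nat using (ℕ; suc; _≤_)
open import Data.Fin using (Fin; toℕ)
open import Data.Product using (_×_; _,_; proj₁; proj₂; Σ)
open import Data.Sum using (_⊎_)
open import Data.List using (List; length; lookup)
open import Data.List.Membership.Propositional using (_∈_)
open import Relation.Binary.PropositionalEquality using (_≡_; _≢_)
open import Relation.Nullary using (¬_)

-- Vertex u_i v_j of the grid G_{n,m} is (i-1 , j-1) : Fin n × Fin m.
GridV : ℕ → ℕ → Set
GridV n m = Fin n × Fin m

Dist1 : ℕ → ℕ → Set
Dist1 a b = (suc a ≡ b) ⊎ (suc b ≡ a)

GridAdj : ∀ {n m} → GridV n m → GridV n m → Set
GridAdj (i , j) (k , l) =
  (i ≡ k × Dist1 (toℕ j) (toℕ l)) ⊎ (j ≡ l × Dist1 (toℕ i) (toℕ k))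

Edge : ℕ → ℕ → Set
Edge n m = GridV n m × GridV n m

EndpointOf : ∀ {n m} → GridV n m → Edge n m → Set
EndpointOf x e = (x ≡ proj₁ e) ⊎ (x ≡ proj₂ e)

Separated : ∀ {n m} → Edge n m → Edge n m → Set
Separated {n} {m} e f =
  (∀ (x : GridV n m) → EndpointOf x e → ¬ EndpointOf x f) ×
  (∀ (x y : GridV n m) → EndpointOf x e → EndpointOf y f → ¬ GridAdj x y)

-- A list M of pairs is an induced matching of G_{n,m}: each entry is an edge
-- of the grid, and entries at distinct positions are separated.
-- (Distinct positions being vertex-disjoint forbids repeated edges, so the
-- size of the matching is length M.)
IsInducedMatching : ∀ {n m} → List (Edge n m) → Set
IsInducedMatching {n} {m} M =
  (∀ (e : Edge n m) → e ∈ M → GridAdj (proj₁ e) (proj₂ e)) ×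
  (∀ (i j : Fin (length M)) → i ≢ j → Separated (lookup M i) (lookup M j))

IsMaximumInducedMatching : ∀ {n m} → List (Edge n m) → Set
IsMaximumInducedMatching {n} {m} M =
  IsInducedMatching M ×
  (∀ (M' : List (Edge n m)) → IsInducedMatching M' → length M' ≤ length M)

Saturated : ∀ {n m} → List (Edge n m) → GridV n m → Set
Saturated {n} {m} M x = Σ (Edge n m) (λ e → e ∈ M × EndpointOf x e)

EdgeIn : ∀ {n m} → GridV n m → GridV n m → List (Edge n m) → Set
EdgeIn a b M = ((a , b) ∈ M) ⊎ ((b , a) ∈ M)

-- Every saturated vertex of an induced matching M has exactly one saturated
-- neighbour, its partner, and M has half as many edges as there are saturated
-- vertices. If u₃v₁ were saturated, u₂v₁ would have the two saturated neighbours
-- u₁v₁ and u₃v₁. If u₄v₁ were, the first column would be saturated in the pattern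
-- 11010 (from u₁ to u₅); a dynamic programme over the 2⁵ saturation patterns of a
-- column shows that then at most 20 vertices of G₅,₉ are saturated, so |M| ≤ 10,
-- whereas G₅,₉ has an induced matching with 11 edges.

module Submission where

open import Defs
open import Data.Bool using (Bool; true; false; T; not; _∧_; _∨_; if_then_else_)
open import Data.Bool.ListAction using (all)
open import Data.Bool.Properties using (T-∧)
open import Data.Empty using (⊥-elim)
open import Data.Fin using (Fin; zero; suc; toℕ; #_)
open import Data.Fin.Properties using (all?) renaming (_≟_ to _≟ᶠ_)
open import Data.List using (List; []; _∷_; length; lookup; map; _++_; allFin; cartesianProductWith)
open import Data.Nat.ListAction using (sum)
open import Data.List.Membership.Propositional using (_∈_; find; lose)
open import Data.List.Membership.Propositional.Properties
  using (∈-allFin; ∈-map⁺; ∈-++⁺ˡ; ∈-++⁺ʳ; ∈-cartesianProductWith⁺)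
open import Data.List.Relation.Unary.All as All using (All; []; _∷_)
open import Data.List.Relation.Unary.All.Properties using (all⁻)
open import Data.List.Relation.Unary.Any using (here; there; index; any?)
open import Data.List.Relation.Unary.Any.Properties using (lookup-index)
open import Data.List.Relation.Unary.AllPairs using ([]; _∷_)
open import Data.List.Relation.Unary.Unique.Propositional using (Unique)
open import Data.List.Relation.Unary.Unique.Propositional.Properties using (cartesianProductWith⁺; allFin⁺)
open import Data.Nat using (ℕ; zero; suc; _+_; _*_; _≤_; _<ᵇ_; _≡ᵇ_; z≤n; s≤s)
open import Data.Nat.Properties
  using (≤-refl; ≤-trans; ≤-reflexive; ≤-antisym; +-assoc; +-suc; *-suc; +-monoʳ-≤; +-mono-≤;
         m≤m+n; m≤n+m; 1+n≢n; ≡⇒≡ᵇ; *-cancelˡ-≤; <-irrefl; +-commutativeSemigroup; ≤-totalOrder; module ≤-Reasoning)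
  renaming (_≟_ to _≟ⁿ_)
open import Algebra.Properties.CommutativeSemigroup +-commutativeSemigroup using (interchange)
open import Data.List.Extrema ≤-totalOrder using (max; xs≤max)
open import Data.Product using (∃; _×_; _,_; proj₁; proj₂)
open import Data.Product.Properties using (≡-dec)
open import Data.Sum using (_⊎_; inj₁; inj₂; [_,_]′; swap)
open import Data.Vec as Vec using (Vec; []; _∷_; replicate)
open import Function using (_∘_; Equivalence)
open import Relation.Binary.Definitions using (DecidableEquality)
open import Relation.Binary.PropositionalEquality
open import Relation.Nullary using (¬_; Dec; yes; no; does)
open import Relation.Nullary.Decidable using (_⊎-dec_; _×-dec_; ¬?; map′; T?; toWitness; dec-true; dec-false)

does-sound : ∀ {A : Set} (a? : Dec A) → T (does a?) → A
does-sound (yes a) _ = a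

does-complete : ∀ {A : Set} (a? : Dec A) → A → T (does a?)
does-complete (yes _) _ = _
does-complete (no ¬a) a = ¬a a

T-not-∨ : ∀ {a b} → (T a → T b) → T (not a ∨ b)
T-not-∨ {false} _   = _
T-not-∨ {true}  a⇒b = a⇒b _

T-∧-proj₁ : ∀ {a b} → T (a ∧ b) → T a
T-∧-proj₁ = proj₁ ∘ Equivalence.to T-∧

T-∧-proj₂ : ∀ {a b} → T (a ∧ b) → T b
T-∧-proj₂ = proj₂ ∘ Equivalence.to T-∧

boolToℕ : Bool → ℕ
boolToℕ false = 0
boolToℕ true  = 1

boolToℕ-T : ∀ {b} → T b → boolToℕ b ≡ 1
boolToℕ-T {true} _ = refl

boolToℕ-¬T : ∀ {b} → ¬ T b → boolToℕ b ≡ 0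
boolToℕ-¬T {false} _  = refl
boolToℕ-¬T {true}  ¬t = ⊥-elim (¬t _)

boolToℕ-∨ : ∀ {a b} → (T a → ¬ T b) → boolToℕ (a ∨ b) ≡ boolToℕ a + boolToℕ b
boolToℕ-∨ {true}  {true}  disj = ⊥-elim (disj _ _)
boolToℕ-∨ {true}  {false} _    = refl
boolToℕ-∨ {false}         _    = refl

countᵇ : {A : Set} → (A → Bool) → List A → ℕ
countᵇ f []       = 0
countᵇ f (x ∷ xs) = boolToℕ (f x) + countᵇ f xs

module _ {A : Set} (f : A → Bool) where

  countᵇ-++ : ∀ xs ys → countᵇ f (xs ++ ys) ≡ countᵇ f xs + countᵇ f ys
  countᵇ-++ []       ys = refl
  countᵇ-++ (x ∷ xs) ys =
    trans (cong (boolToℕ (f x) +_) (countᵇ-++ xs ys)) (sym (+-assoc (boolToℕ (f x)) _ _))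

  countᵇ-cartesianProductWith : ∀ {B C : Set} (g : B → C → A) xs ys →
    countᵇ f (cartesianProductWith g xs ys) ≡ sum (map (λ x → countᵇ f (map (g x) ys)) xs)
  countᵇ-cartesianProductWith g []       ys = refl
  countᵇ-cartesianProductWith g (x ∷ xs) ys =
    trans (countᵇ-++ (map (g x) ys) _) (cong (_ +_) (countᵇ-cartesianProductWith g xs ys))

  countᵇ-≥1 : ∀ {x xs} → x ∈ xs → T (f x) → 1 ≤ countᵇ f xs
  countᵇ-≥1 (here refl) fx rewrite boolToℕ-T fx = s≤s z≤n
  countᵇ-≥1 {xs = y ∷ _} (there x∈) fx = ≤-trans (countᵇ-≥1 x∈ fx) (m≤n+m _ (boolToℕ (f y)))

  countᵇ-≥2 : ∀ {x y xs} → x ∈ xs → y ∈ xs → x ≢ y → T (f x) → T (f y) → 2 ≤ countᵇ f xs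
  countᵇ-≥2 (here refl)  (here refl)  x≢y _  _  = ⊥-elim (x≢y refl)
  countᵇ-≥2 (here refl)  (there y∈)   _   fx fy rewrite boolToℕ-T fx = s≤s (countᵇ-≥1 y∈ fy)
  countᵇ-≥2 (there x∈)   (here refl)  _   fx fy rewrite boolToℕ-T fy = s≤s (countᵇ-≥1 x∈ fx)
  countᵇ-≥2 {xs = z ∷ _} (there x∈) (there y∈) x≢y fx fy =
    ≤-trans (countᵇ-≥2 x∈ y∈ x≢y fx fy) (m≤n+m _ (boolToℕ (f z)))

  countᵇ-none : ∀ {xs} → All (λ x → ¬ T (f x)) xs → countᵇ f xs ≡ 0
  countᵇ-none []           = refl
  countᵇ-none (¬fx ∷ ¬fxs) rewrite boolToℕ-¬T ¬fx = countᵇ-none ¬fxs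

  countᵇ-≤1 : ∀ {xs} → Unique xs → (∀ {x y} → T (f x) → T (f y) → x ≡ y) → countᵇ f xs ≤ 1
  countᵇ-≤1 []                   _       = z≤n
  countᵇ-≤1 {x ∷ _} (x∉xs ∷ uniq) at-most with T? (f x)
  ... | yes fx rewrite boolToℕ-T fx
                     | countᵇ-none (All.map (λ x≢y fy → x≢y (at-most fx fy)) x∉xs) = ≤-refl
  ... | no ¬fx rewrite boolToℕ-¬T ¬fx = countᵇ-≤1 uniq at-most

  countᵇ-∨ : ∀ {g : A → Bool} → (∀ x → T (f x) → ¬ T (g x)) → ∀ xs →
    countᵇ (λ x → f x ∨ g x) xs ≡ countᵇ f xs + countᵇ g xs
  countᵇ-∨         disj []       = refl
  countᵇ-∨ {g = g} disj (x ∷ xs) = begin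
    boolToℕ (f x ∨ g x) + countᵇ (λ x → f x ∨ g x) xs
      ≡⟨ cong₂ _+_ (boolToℕ-∨ (disj x)) (countᵇ-∨ disj xs) ⟩
    (boolToℕ (f x) + boolToℕ (g x)) + (countᵇ f xs + countᵇ g xs)
      ≡⟨ interchange (boolToℕ (f x)) _ _ _ ⟩
    (boolToℕ (f x) + countᵇ f xs) + (boolToℕ (g x) + countᵇ g xs) ∎
    where open ≡-Reasoning

dist1-irrefl : ∀ a → ¬ Dist1 a a
dist1-irrefl a (inj₁ p) = 1+n≢n p
dist1-irrefl a (inj₂ p) = 1+n≢n p

dist1? : ∀ a b → Dec (Dist1 a b)
dist1? a b = (suc a ≟ⁿ b) ⊎-dec (suc b ≟ⁿ a)

module _ {n m : ℕ} where

  gridAdj-irrefl : ∀ {x : GridV n m} → ¬ GridAdj x x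
  gridAdj-irrefl (inj₁ (_ , d)) = dist1-irrefl _ d
  gridAdj-irrefl (inj₂ (_ , d)) = dist1-irrefl _ d

  gridAdj⇒≢ : ∀ {x y : GridV n m} → GridAdj x y → x ≢ y
  gridAdj⇒≢ adj refl = gridAdj-irrefl adj

  gridAdj-sym : ∀ {x y : GridV n m} → GridAdj x y → GridAdj y x
  gridAdj-sym (inj₁ (i≡k , d)) = inj₁ (sym i≡k , swap d)
  gridAdj-sym (inj₂ (j≡l , d)) = inj₂ (sym j≡l , swap d)

  gridAdj? : (x y : GridV n m) → Dec (GridAdj x y)
  gridAdj? (i , j) (k , l) =
    ((i ≟ᶠ k) ×-dec dist1? (toℕ j) (toℕ l)) ⊎-dec ((j ≟ᶠ l) ×-dec dist1? (toℕ i) (toℕ k))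

  _≟ᵛ_ : DecidableEquality (GridV n m)
  _≟ᵛ_ = ≡-dec _≟ᶠ_ _≟ᶠ_

vertices : ∀ n m → List (GridV n m)
vertices n m = cartesianProductWith (λ j i → i , j) (allFin m) (allFin n)

∈-vertices : ∀ {n m} (x : GridV n m) → x ∈ vertices n m
∈-vertices (i , j) = ∈-cartesianProductWith⁺ (λ j i → i , j) (∈-allFin j) (∈-allFin i)

vertices-unique : ∀ n m → Unique (vertices n m)
vertices-unique n m = cartesianProductWith⁺ _ (λ { refl → refl , refl }) (allFin⁺ m) (allFin⁺ n)

module _ {n m : ℕ} where

  endpoint? : (x : GridV n m) (e : Edge n m) → Dec (EndpointOf x e)
  endpoint? x (a , b) = (x ≟ᵛ a) ⊎-dec (x ≟ᵛ b)

  saturated? : (M : List (Edge n m)) (x : GridV n m) → Dec (Saturated M x)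
  saturated? M x = map′ find (λ (_ , e∈M , x∈e) → lose e∈M x∈e) (any? (endpoint? x) M)

  isSaturated : List (Edge n m) → GridV n m → Bool
  isSaturated M x = does (saturated? M x)

  saturatedCount : List (Edge n m) → ℕ
  saturatedCount M = countᵇ (isSaturated M) (vertices n m)

  isSaturatedNeighbour : List (Edge n m) → GridV n m → GridV n m → Bool
  isSaturatedNeighbour M x y = does (gridAdj? x y) ∧ isSaturated M y

  isSaturatedNeighbour-sound : ∀ {M x y} → T (isSaturatedNeighbour M x y) → GridAdj x y × Saturated M y
  isSaturatedNeighbour-sound {M} {x} {y} ok =
    does-sound (gridAdj? x y) (T-∧-proj₁ ok) , does-sound (saturated? M y) (T-∧-proj₂ ok)

  isSaturatedNeighbour-complete : ∀ {M x y} → GridAdj x y → Saturated M y → T (isSaturatedNeighbour M x y)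
  isSaturatedNeighbour-complete {M} {x} {y} x~y sat-y =
    Equivalence.from T-∧ (does-complete (gridAdj? x y) x~y , does-complete (saturated? M y) sat-y)

  saturatedNeighbours : List (Edge n m) → GridV n m → ℕ
  saturatedNeighbours M x = countᵇ (isSaturatedNeighbour M x) (vertices n m)

  endpoint-third : ∀ {e : Edge n m} {x y z} → EndpointOf x e → EndpointOf y e → EndpointOf z e →
    x ≢ y → x ≢ z → y ≡ z
  endpoint-third _           (inj₁ refl) (inj₁ refl) _   _   = refl
  endpoint-third _           (inj₂ refl) (inj₂ refl) _   _   = refl
  endpoint-third (inj₁ refl) (inj₁ refl) (inj₂ refl) x≢y _   = ⊥-elim (x≢y refl)
  endpoint-third (inj₂ refl) (inj₁ refl) (inj₂ refl) _   x≢z = ⊥-elim (x≢z refl)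
  endpoint-third (inj₁ refl) (inj₂ refl) (inj₁ refl) _   x≢z = ⊥-elim (x≢z refl)
  endpoint-third (inj₂ refl) (inj₂ refl) (inj₁ refl) x≢y _   = ⊥-elim (x≢y refl)

  inducedMatching-tail : ∀ {e : Edge n m} {M} → IsInducedMatching (e ∷ M) → IsInducedMatching M
  inducedMatching-tail (edges , separated) =
    (λ f f∈M → edges f (there f∈M)) ,
    (λ i j i≢j → separated (suc i) (suc j) (λ { refl → i≢j refl }))

  module _ {M : List (Edge n m)} (im : IsInducedMatching M) where

    adjacent-endpoint-same-edge : ∀ {e f x y} → e ∈ M → f ∈ M → EndpointOf x e → EndpointOf y f →
      GridAdj x y → EndpointOf y e
    adjacent-endpoint-same-edge e∈M f∈M x∈e y∈f adj with index e∈M ≟ᶠ index f∈M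
    ... | yes same = subst (EndpointOf _) (trans (lookup-index f∈M)
                       (trans (cong (lookup M) (sym same)) (sym (lookup-index e∈M)))) y∈f
    ... | no differ = ⊥-elim (proj₂ (proj₂ im _ _ differ) _ _
                        (subst (EndpointOf _) (lookup-index e∈M) x∈e)
                        (subst (EndpointOf _) (lookup-index f∈M) y∈f) adj)

    partner : ∀ {x} → Saturated M x → ∃ λ y → GridAdj x y × Saturated M y
    partner (e , e∈M , inj₁ refl) = proj₂ e , proj₁ im e e∈M , e , e∈M , inj₂ refl
    partner (e , e∈M , inj₂ refl) = proj₁ e , gridAdj-sym (proj₁ im e e∈M) , e , e∈M , inj₁ refl

    saturated-neighbour-unique : ∀ {x y z} → Saturated M x → GridAdj x y → GridAdj x z →
      Saturated M y → Saturated M z → y ≡ z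
    saturated-neighbour-unique (e , e∈M , x∈e) x~y x~z (f , f∈M , y∈f) (g , g∈M , z∈g) =
      endpoint-third x∈e
        (adjacent-endpoint-same-edge e∈M f∈M x∈e y∈f x~y)
        (adjacent-endpoint-same-edge e∈M g∈M x∈e z∈g x~z)
        (gridAdj⇒≢ x~y) (gridAdj⇒≢ x~z)

    saturatedNeighbours≡1 : ∀ {x} → Saturated M x → saturatedNeighbours M x ≡ 1
    saturatedNeighbours≡1 {x} sat-x with partner sat-x
    ... | y , x~y , sat-y = ≤-antisym
      (countᵇ-≤1 _ (vertices-unique n m) λ z-ok z′-ok →
        let x~z  , sat-z  = isSaturatedNeighbour-sound z-ok
            x~z′ , sat-z′ = isSaturatedNeighbour-sound z′-ok
        in saturated-neighbour-unique sat-x x~z x~z′ sat-z sat-z′)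
      (countᵇ-≥1 _ (∈-vertices y) (isSaturatedNeighbour-complete x~y sat-y))

    saturated⇒one-saturated-neighbour : ∀ x →
      T (not (isSaturated M x) ∨ (saturatedNeighbours M x ≡ᵇ 1))
    saturated⇒one-saturated-neighbour x = T-not-∨ λ sat-x →
      ≡⇒≡ᵇ _ 1 (saturatedNeighbours≡1 (does-sound (saturated? M x) sat-x))

  -- `isSaturated (e ∷ M) x` unfolds to `does (endpoint? x e) ∨ isSaturated M x`.
  2*length≤saturatedCount : ∀ {M : List (Edge n m)} → IsInducedMatching M →
    2 * length M ≤ saturatedCount M
  2*length≤saturatedCount {[]}    _  = z≤n
  2*length≤saturatedCount {e ∷ M} im = begin
    2 * suc (length M)
      ≡⟨ *-suc 2 (length M) ⟩
    2 + 2 * length M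
      ≤⟨ +-mono-≤ endpoints (2*length≤saturatedCount (inducedMatching-tail im)) ⟩
    countᵇ (λ x → does (endpoint? x e)) (vertices n m) + saturatedCount M
      ≡⟨ sym (countᵇ-∨ _ disjoint (vertices n m)) ⟩
    saturatedCount (e ∷ M) ∎
    where
    open ≤-Reasoning
    endpoints : 2 ≤ countᵇ (λ x → does (endpoint? x e)) (vertices n m)
    endpoints = countᵇ-≥2 _ (∈-vertices (proj₁ e)) (∈-vertices (proj₂ e))
      (gridAdj⇒≢ (proj₁ im e (here refl)))
      (does-complete (endpoint? _ e) (inj₁ refl)) (does-complete (endpoint? _ e) (inj₂ refl))
    disjoint : ∀ x → T (does (endpoint? x e)) → ¬ T (isSaturated M x)
    disjoint x x∈e sat-x with does-sound (saturated? M x) sat-x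
    ... | f , f∈M , x∈f = proj₁ (proj₂ im zero (suc (index f∈M)) (λ ())) x
      (does-sound (endpoint? x e) x∈e) (subst (EndpointOf x) (lookup-index f∈M) x∈f)

  endpointPairs : Edge n m → Edge n m → List (GridV n m × GridV n m)
  endpointPairs (a , b) (c , d) = (a , c) ∷ (a , d) ∷ (b , c) ∷ (b , d) ∷ []

  SeparatedEndpoints : Edge n m → Edge n m → Set
  SeparatedEndpoints e f = All (λ (x , y) → x ≢ y × ¬ GridAdj x y) (endpointPairs e f)

  separatedEndpoints? : (e f : Edge n m) → Dec (SeparatedEndpoints e f)
  separatedEndpoints? e f = All.all? (λ (x , y) → ¬? (x ≟ᵛ y) ×-dec ¬? (gridAdj? x y)) (endpointPairs e f)

  separatedEndpoints⇒separated : ∀ {e f} → SeparatedEndpoints e f → Separated e f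
  separatedEndpoints⇒separated {e} {f} ok =
    (λ x x∈e x∈f → proj₁ (endpoints x∈e x∈f) refl) ,
    (λ x y x∈e y∈f → proj₂ (endpoints x∈e y∈f))
    where
    endpoints : ∀ {x y} → EndpointOf x e → EndpointOf y f → x ≢ y × ¬ GridAdj x y
    endpoints (inj₁ refl) (inj₁ refl) = All.lookup ok (here refl)
    endpoints (inj₁ refl) (inj₂ refl) = All.lookup ok (there (here refl))
    endpoints (inj₂ refl) (inj₁ refl) = All.lookup ok (there (there (here refl)))
    endpoints (inj₂ refl) (inj₂ refl) = All.lookup ok (there (there (there (here refl))))

  inducedMatching-from-endpoints : ∀ {M : List (Edge n m)} →
    All (λ e → GridAdj (proj₁ e) (proj₂ e)) M →
    (∀ i j → i ≡ j ⊎ SeparatedEndpoints (lookup M i) (lookup M j)) →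
    IsInducedMatching M
  inducedMatching-from-endpoints edges pairs =
    (λ e e∈M → All.lookup edges e∈M) ,
    (λ i j i≢j → [ ⊥-elim ∘ i≢j , separatedEndpoints⇒separated ]′ (pairs i j))

  edgeIn-saturated : ∀ {a b : GridV n m} {M} → EdgeIn a b M → Saturated M a × Saturated M b
  edgeIn-saturated (inj₁ ab∈M) = (_ , ab∈M , inj₁ refl) , (_ , ab∈M , inj₂ refl)
  edgeIn-saturated (inj₂ ba∈M) = (_ , ba∈M , inj₂ refl) , (_ , ba∈M , inj₁ refl)

Column : ℕ → Set
Column h = Vec Bool h

weight : ∀ {h} → Column h → ℕ
weight []       = 0
weight (b ∷ bs) = boolToℕ b + weight bs

totalWeight : ∀ {h k} → Vec (Column h) k → ℕ
totalWeight []       = 0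
totalWeight (c ∷ cs) = weight c + totalWeight cs

empty : ∀ {h} → Column h
empty = replicate _ false

headOrFalse : ∀ {h} → Column h → Bool
headOrFalse []      = false
headOrFalse (b ∷ _) = b

exactlyOne : List Bool → Bool
exactlyOne bs = countᵇ (λ b → b) bs ≡ᵇ 1

-- The four flags passed to `exactlyOne` are the west, north, south and east neighbours.
rowsCompatible : ∀ {h} → Bool → Column h → Column h → Column h → Bool
rowsCompatible above []       []       []       = true
rowsCompatible above (w ∷ ws) (c ∷ cs) (e ∷ es) =
  (not c ∨ exactlyOne (w ∷ above ∷ headOrFalse cs ∷ e ∷ [])) ∧ rowsCompatible c ws cs es

compatible : ∀ {h} → Column h → Column h → Column h → Bool
compatible = rowsCompatible false

-- The trailing `∧ true` makes a chain definitionally a `Data.Bool.ListAction.all`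
-- over its columns, which is how `columns-compatibleChain` is proved.
compatibleChain : ∀ {h k} → Column h → Column h → Vec (Column h) k → Bool
compatibleChain w c []       = compatible w c empty ∧ true
compatibleChain w c (e ∷ cs) = compatible w c e ∧ compatibleChain c e cs

allColumns : ∀ h → List (Column h)
allColumns zero    = [] ∷ []
allColumns (suc h) = map (true ∷_) (allColumns h) ++ map (false ∷_) (allColumns h)

∈-allColumns : ∀ {h} (c : Column h) → c ∈ allColumns h
∈-allColumns []          = here refl
∈-allColumns (true ∷ c)  = ∈-++⁺ˡ (∈-map⁺ (true ∷_) (∈-allColumns c))
∈-allColumns (false ∷ c) = ∈-++⁺ʳ _ (∈-map⁺ (false ∷_) (∈-allColumns c))

data Trie (A : Set) : ℕ → Set where
  leaf : A → Trie A zero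
  node : ∀ {n} → Trie A n → Trie A n → Trie A (suc n)

lookupᵗ : ∀ {n} {A : Set} → Trie A n → Vec Bool n → A
lookupᵗ (leaf a)   []          = a
lookupᵗ (node t f) (true ∷ v)  = lookupᵗ t v
lookupᵗ (node t f) (false ∷ v) = lookupᵗ f v

tabulateᵗ : ∀ {n} {A : Set} → (Vec Bool n → A) → Trie A n
tabulateᵗ {zero}  g = leaf (g [])
tabulateᵗ {suc n} g = node (tabulateᵗ (λ v → g (true ∷ v))) (tabulateᵗ (λ v → g (false ∷ v)))

lookupᵗ-tabulateᵗ : ∀ {n} {A : Set} (g : Vec Bool n → A) v → lookupᵗ (tabulateᵗ g) v ≡ g v
lookupᵗ-tabulateᵗ g []          = refl
lookupᵗ-tabulateᵗ g (true ∷ v)  = lookupᵗ-tabulateᵗ (λ w → g (true ∷ w)) v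
lookupᵗ-tabulateᵗ g (false ∷ v) = lookupᵗ-tabulateᵗ (λ w → g (false ∷ w)) v

Table : ℕ → Set
Table h = Trie (Trie ℕ h) h

tabulate² : ∀ {h} → (Column h → Column h → ℕ) → Table h
tabulate² g = tabulateᵗ λ w → tabulateᵗ (g w)

lookup² : ∀ {h} → Table h → Column h → Column h → ℕ
lookup² t w c = lookupᵗ (lookupᵗ t w) c

lookup²-tabulate² : ∀ {h} (g : Column h → Column h → ℕ) w c → lookup² (tabulate² g) w c ≡ g w c
lookup²-tabulate² g w c =
  trans (cong (λ t → lookupᵗ t c) (lookupᵗ-tabulateᵗ (λ w → tabulateᵗ (g w)) w))
        (lookupᵗ-tabulateᵗ (g w) c)

-- best k w c is one more than the largest total weight of k columns e₁ … eₖ for which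
-- w c e₁ … eₖ empty is a compatible chain, and 0 if there are none; `table` memoises it.
extend : ∀ {h} → (Column h → Column h → ℕ) → Column h → Column h → Column h → ℕ
extend b w c e = if compatible w c e ∧ (0 <ᵇ b c e) then weight e + b c e else 0

improve : ∀ {h} → Table h → Table h
improve {h} t = tabulate² λ w c → max 0 (map (extend (lookup² t) w c) (allColumns h))

table : ∀ h → ℕ → Table h
table h zero    = tabulate² λ w c → boolToℕ (compatible w c empty)
table h (suc k) = improve (table h k)

best : ∀ {h} → ℕ → Column h → Column h → ℕ
best {h} k = lookup² (table h k)

best-zero : ∀ {h} (w c : Column h) → best 0 w c ≡ boolToℕ (compatible w c empty)
best-zero w c = lookup²-tabulate² _ w c

best-suc : ∀ {h} k (w c : Column h) →
  best (suc k) w c ≡ max 0 (map (extend (best k) w c) (allColumns h))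
best-suc k w c = lookup²-tabulate² _ w c

extend-≥ : ∀ {h} (b : Column h → Column h → ℕ) {w c e : Column h} {s} →
  T (compatible w c e) → suc s ≤ b c e → suc (weight e + s) ≤ extend b w c e
extend-≥ b {w} {c} {e} {s} _ s<b with compatible w c e | b c e
... | true | suc v = ≤-trans (≤-reflexive (sym (+-suc (weight e) s))) (+-monoʳ-≤ (weight e) s<b)

chain-sound : ∀ {h k} {w c : Column h} (cs : Vec (Column h) k) →
  T (compatibleChain w c cs) → suc (totalWeight cs) ≤ best k w c
chain-sound {w = w} {c} [] ok =
  ≤-reflexive (sym (trans (best-zero w c) (boolToℕ-T (T-∧-proj₁ ok))))
chain-sound {k = suc k} {w} {c} (e ∷ cs) ok = begin
  suc (weight e + totalWeight cs)
    ≤⟨ extend-≥ (best k) {w} (T-∧-proj₁ ok) (chain-sound cs (T-∧-proj₂ ok)) ⟩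
  extend (best k) w c e
    ≤⟨ All.lookup (xs≤max 0 _) (∈-map⁺ _ (∈-allColumns e)) ⟩
  max 0 (map (extend (best k) w c) (allColumns _))
    ≡⟨ sym (best-suc k w c) ⟩
  best (suc k) w c ∎
  where open ≤-Reasoning

column : List (Edge 5 9) → Fin 9 → Column 5
column M j = Vec.tabulate λ i → isSaturated M (i , j)

laterColumns : List (Edge 5 9) → Vec (Column 5) 8
laterColumns M = Vec.tabulate (column M ∘ suc)

saturatedCount≡columnWeights : ∀ M →
  saturatedCount M ≡ weight (column M zero) + totalWeight (laterColumns M)
saturatedCount≡columnWeights M =
  countᵇ-cartesianProductWith (isSaturated M) (λ j i → i , j) (allFin 9) (allFin 5)

-- For each concrete cell the two Boolean conditions are the same term: `vertices` lists
-- the grid column by column, so `saturatedNeighbours` adds up the west, north, south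
-- and east neighbours in the order of `rowsCompatible`, and absent neighbours count 0
-- on both sides.
columns-compatibleChain : ∀ {M} → IsInducedMatching M →
  T (compatibleChain empty (column M zero) (laterColumns M))
columns-compatibleChain {M} im = all⁻ columnOK {xs = allFin 9} (All.tabulate λ {j} _ → columnOK-true j)
  where
  cellOK : GridV 5 9 → Bool
  cellOK x = not (isSaturated M x) ∨ (saturatedNeighbours M x ≡ᵇ 1)
  columnOK : Fin 9 → Bool
  columnOK j = all (λ i → cellOK (i , j)) (allFin 5)
  columnOK-true : ∀ j → T (columnOK j)
  columnOK-true j =
    all⁻ _ {xs = allFin 5} (All.tabulate λ {i} _ → saturated⇒one-saturated-neighbour im (i , j))

chain-weight≤20 : ∀ {c} (cs : Vec (Column 5) 8) → c ≡ true ∷ true ∷ false ∷ true ∷ false ∷ [] →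
  T (compatibleChain empty c cs) → weight c + totalWeight cs ≤ 20
chain-weight≤20 cs refl ok = s≤s (s≤s (chain-sound cs ok))

firstColumn11010⇒length≤10 : ∀ {M} → IsInducedMatching M →
  column M zero ≡ true ∷ true ∷ false ∷ true ∷ false ∷ [] → length M ≤ 10
firstColumn11010⇒length≤10 {M} im firstColumn = *-cancelˡ-≤ 2 (begin
  2 * length M
    ≤⟨ 2*length≤saturatedCount im ⟩
  saturatedCount M
    ≡⟨ saturatedCount≡columnWeights M ⟩
  weight (column M zero) + totalWeight (laterColumns M)
    ≤⟨ chain-weight≤20 (laterColumns M) firstColumn (columns-compatibleChain im) ⟩
  20 ∎)
  where open ≤-Reasoning

elevenEdges : List (Edge 5 9)
elevenEdges =
  ((# 0 , # 0) , (# 0 , # 1)) ∷ ((# 0 , # 3) , (# 0 , # 4)) ∷ ((# 0 , # 7) , (# 0 , # 8)) ∷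
  ((# 1 , # 5) , (# 1 , # 6)) ∷
  ((# 2 , # 0) , (# 2 , # 1)) ∷ ((# 2 , # 3) , (# 2 , # 4)) ∷ ((# 2 , # 7) , (# 2 , # 8)) ∷
  ((# 3 , # 5) , (# 3 , # 6)) ∷
  ((# 4 , # 0) , (# 4 , # 1)) ∷ ((# 4 , # 3) , (# 4 , # 4)) ∷ ((# 4 , # 7) , (# 4 , # 8)) ∷ []

elevenEdges-inducedMatching : IsInducedMatching elevenEdges
elevenEdges-inducedMatching = inducedMatching-from-endpoints
  (toWitness {a? = All.all? (λ e → gridAdj? (proj₁ e) (proj₂ e)) elevenEdges} _)
  (toWitness {a? = all? λ i → all? λ j →
    (i ≟ᶠ j) ⊎-dec separatedEndpoints? (lookup elevenEdges i) (lookup elevenEdges j)} _)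

u₃v₁-unsaturated : ∀ {M : List (Edge 5 9)} → IsInducedMatching M → EdgeIn (# 0 , # 0) (# 1 , # 0) M →
  ¬ Saturated M (# 2 , # 0)
u₃v₁-unsaturated {M} im u₁u₂∈M sat-u₃ =
  u₁v₁≢u₃v₁ (saturated-neighbour-unique im sat-u₂ u₂~u₁ u₂~u₃ (proj₁ (edgeIn-saturated u₁u₂∈M)) sat-u₃)
  where
  sat-u₂ : Saturated M (# 1 , # 0)
  sat-u₂ = proj₂ (edgeIn-saturated u₁u₂∈M)
  u₂~u₁ : GridAdj {5} {9} (# 1 , # 0) (# 0 , # 0)
  u₂~u₁ = inj₂ (refl , inj₂ refl)
  u₂~u₃ : GridAdj {5} {9} (# 1 , # 0) (# 2 , # 0)
  u₂~u₃ = inj₂ (refl , inj₁ refl)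
  u₁v₁≢u₃v₁ : (# 0 , # 0) ≢ (# 2 , # 0)
  u₁v₁≢u₃v₁ ()

firstColumn≡11010 : ∀ {M : List (Edge 5 9)} →
  Saturated M (# 0 , # 0) → Saturated M (# 1 , # 0) → ¬ Saturated M (# 2 , # 0) →
  Saturated M (# 3 , # 0) → ¬ Saturated M (# 4 , # 0) →
  column M zero ≡ true ∷ true ∷ false ∷ true ∷ false ∷ []
firstColumn≡11010 {M} s₁ s₂ ¬s₃ s₄ ¬s₅ =
  cong₂ _∷_ (dec-true (saturated? M _) s₁) (cong₂ _∷_ (dec-true (saturated? M _) s₂)
  (cong₂ _∷_ (dec-false (saturated? M _) ¬s₃) (cong₂ _∷_ (dec-true (saturated? M _) s₄)
  (cong₂ _∷_ (dec-false (saturated? M _) ¬s₅) refl))))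

maximum-firstColumn≢11010 : ∀ {M} → IsMaximumInducedMatching M →
  column M zero ≢ true ∷ true ∷ false ∷ true ∷ false ∷ []
maximum-firstColumn≢11010 (im , maximal) firstColumn =
  <-irrefl refl (≤-trans (maximal elevenEdges elevenEdges-inducedMatching)
                         (firstColumn11010⇒length≤10 im firstColumn))

lemma3p13 : (M : List (Edge 5 9)) →
    IsMaximumInducedMatching M →
    EdgeIn (Fin.zero , Fin.zero) (Fin.suc Fin.zero , Fin.zero) M →
    (∀ (w w' : Fin 5) → 2 ≤ toℕ w → 2 ≤ toℕ w' →
      Saturated M (w , Fin.zero) → Saturated M (w' , Fin.zero) → w ≡ w') →
    (w : Fin 5) → 2 ≤ toℕ w → Saturated M (w , Fin.zero) →
    w ≡ Fin.suc (Fin.suc (Fin.suc (Fin.suc Fin.zero)))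
lemma3p13 M _ _ _ zero () _
lemma3p13 M _ _ _ (suc zero) (s≤s ()) _
lemma3p13 M (im , _) u₁u₂∈M _ (suc (suc zero)) _ sat-u₃ = ⊥-elim (u₃v₁-unsaturated im u₁u₂∈M sat-u₃)
lemma3p13 M max u₁u₂∈M atMostOne (suc (suc (suc zero))) 2≤u₄ sat-u₄ =
  ⊥-elim (maximum-firstColumn≢11010 max
    (firstColumn≡11010 sat-u₁ sat-u₂ (unsaturated ≤-refl λ ()) sat-u₄ (unsaturated (m≤m+n 2 2) λ ())))
  where
  sat-u₁ : Saturated M (# 0 , # 0)
  sat-u₁ = proj₁ (edgeIn-saturated u₁u₂∈M)
  sat-u₂ : Saturated M (# 1 , # 0)
  sat-u₂ = proj₂ (edgeIn-saturated u₁u₂∈M)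
  unsaturated : ∀ {w} → 2 ≤ toℕ w → w ≢ # 3 → ¬ Saturated M (w , zero)
  unsaturated 2≤w w≢u₄ sat-w = w≢u₄ (atMostOne _ _ 2≤w 2≤u₄ sat-w sat-u₄)
lemma3p13 M _ _ _ (suc (suc (suc (suc zero)))) _ _ = refl
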